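{- Let $G$ be a connected $d$-regular graph on $n$ vertices containing exactly one sink $s$, and let $\sigma$ be a configuration with $N$ chips in total on the non-sink vertices. Then the following greedy simulation algorithm terminates after $O(n^3\log(nN))$ iterations: while some non-sink vertex is full, choose a non-sink vertex $u$ maximizing $\lfloor\sigma_u/\deg(u)\rfloor$, let $k=\lfloor\sigma_u/\deg(u)\rfloor$, set $\sigma_u\leftarrow\sigma_u-k\deg(u)$ and add $k$ chips to every non-sink neighbor of $u$ (one iteration = one execution of this loop body).
   Context: Sandpile with a sink: $\sigma\in\mathbb{N}^{V(G)}$ gives chip counts. The sink $s$ never fires and chips sent to it are discarded. A non-sink vertex $v$ is full if $\sigma_v\ge\deg(v)$ (degree counts all neighbors, including $s$); firing $v$ decreases $\sigma_v$ by $\deg(v)$ and adds one chip to each neighbor. A configuration is terminal if no non-sink vertex is full. -}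

module Defs where

open import Data.Nat using (ℕ; zero; suc; _+_; _*_; _∸_; _≤_; _/_)
open import Data.Fin using (Fin; _≟_)
open import Data.Bool using (Bool; true; false; if_then_else_)
open import Data.List using (List; map; allFin)
open import Data.Nat.ListAction using (sum)
open import Data.Product using (Σ; ∃; _×_)
open import Relation.Binary.PropositionalEquality using (_≡_; _≢_)
open import Relation.Binary.Construct.Closure.ReflexiveTransitive using (Star)
open import Relation.Nullary using (¬_; yes; no)
open import Relation.Nullary.Decidable using (⌊_⌋)

record SimpleGraph (n : ℕ) : Set where
  field
    Adj     : Fin n → Fin n → Bool
    sym     : ∀ u v → Adj u v ≡ Adj v u
    irrefl  : ∀ v → Adj v v ≡ false

open SimpleGraph public

ind : Bool → ℕ
ind true  = 1
ind false = 0

-- degree of v: number of neighbours of v (including the sink, if adjacent)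
deg : ∀ {n} → SimpleGraph n → Fin n → ℕ
deg {n} G v = sum (map (λ w → ind (Adj G v w)) (allFin n))

Regular : ∀ {n} → SimpleGraph n → ℕ → Set
Regular G d = ∀ v → deg G v ≡ d

Connected : ∀ {n} → SimpleGraph n → Set
Connected G = ∀ u v → Star (λ x y → Adj G x y ≡ true) u v

-- configurations: chip counts on all vertices (the sink's value is ignored)
Config : ℕ → Set
Config n = Fin n → ℕ

chipsOff : ∀ {n} → Fin n → Config n → ℕ
chipsOff {n} s σ = sum (map (λ v → if ⌊ v ≟ s ⌋ then 0 else σ v) (allFin n))

-- floor division, with the (irrelevant) convention  a ÷ 0 = 0
_÷_ : ℕ → ℕ → ℕ
a ÷ zero  = 0
a ÷ suc b = a / suc b

module _ {n : ℕ} (G : SimpleGraph n) (s : Fin n) where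

  Full : Config n → Fin n → Set
  Full σ v = v ≢ s × deg G v ≤ σ v

  greedyFire : Config n → Fin n → Config n
  greedyFire σ u v with v ≟ u | v ≟ s
  ... | yes _ | _     = σ u ∸ (σ u ÷ deg G u) * deg G u
  ... | no _  | yes _ = σ v
  ... | no _  | no _  = if Adj G u v then σ v + (σ u ÷ deg G u) else σ v

  GreedyStep : Config n → Config n → Set
  GreedyStep σ σ' =
    (∃ λ w → Full σ w) ×
    Σ (Fin n) λ u →
      (u ≢ s) ×
      (∀ v → v ≢ s → σ v ÷ deg G v ≤ σ u ÷ deg G u) ×
      (∀ v → σ' v ≡ greedyFire σ u v)

  data GreedyRun : ℕ → Config n → Config n → Set where
    done : ∀ {σ} → GreedyRun 0 σ σ
    step : ∀ {k σ σ' σ''} → GreedyStep σ σ' → GreedyRun k σ' σ'' →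
           GreedyRun (suc k) σ σ''

-- Pick a potential y on the vertices with y_s = 0 whose Laplacian
-- (Δy)_u = d·y_u − Σ_{w∼u} y_w lies between d and 2d at every non-sink u.
-- For Φ(σ) = Σ_u y_u·σ_u, an iteration firing u with multiplier k lowers Φ by
-- k·(Δy)_u ≥ k·d, while maximality of k gives σ_v < (k+1)·d everywhere, so
-- Φ(σ) ≤ (k+1)·d·Σy: each iteration multiplies Φ by at most 1 − 1/(2Σy + 1).
-- Since Δy ≤ 2d, the Dirichlet energy Σ_{u∼w} (y_u − y_w)² is at most 4d·Σy;
-- along a shortest path from v to s, of length L with L·(d+1) ≤ 3n,
-- Cauchy–Schwarz gives y_v² ≤ 12n·Σy, hence Σy ≤ 12n³. Initially Φ ≤ 12n³·N,
-- so O(n³ log(nN)) iterations exhaust it.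
module Submission where

open import Defs hiding (sym)
open import Data.Bool using (true; false; if_then_else_)
open import Data.Bool.Properties using () renaming (_≟_ to _≟ᵇ_)
open import Data.Empty using (⊥-elim)
open import Data.Fin using (Fin; zero; suc; toℕ; _≟_)
open import Data.Fin.Properties using (0≢1+n; any?; suc-injective; toℕ-injective; toℕ<n)
open import Data.List using (map; allFin; tabulate)
open import Data.List.Properties using (map-tabulate)
open import Data.Nat hiding (_≟_)
open import Data.Nat using () renaming (_≟_ to _≟ℕ_)
open import Data.Nat.DivMod using (m/n*n≤m; m%n<n; m≡m%n+[m/n]*n; m≥n⇒m/n>0)
open import Data.Nat.Induction using (<-rec; <-wellFounded)
open import Data.Nat.ListAction as List using ()
open import Data.Nat.Logarithm using (⌈log₂_⌉; ⌈log₂⌉-mono-≤; ⌈log₂2^n⌉≡n)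
open import Data.Nat.Logarithm.Core using (⌈log2⌉)
open import Data.Nat.Properties hiding (_≟_; suc-injective; 0≢1+n)
open import Data.Nat.Tactic.RingSolver using (solve-∀)
open import Data.Product using (Σ; ∃; _×_; _,_; proj₁; proj₂)
open import Data.Sum using (_⊎_; inj₁; inj₂)
open import Data.Vec.Functional using (updateAt)
open import Data.Vec.Functional.Properties using (updateAt-updates; updateAt-minimal)
open import Function using (_∘_; id; const)
open import Function.Definitions using (Injective)
open import Induction.WellFounded using (Acc; acc)
open import Relation.Binary.Construct.Closure.ReflexiveTransitive using (Star; ε; _◅_)
open import Relation.Binary.Definitions using (DecidableEquality; tri<; tri≈; tri>)
open import Relation.Binary.PropositionalEquality
open import Relation.Nullary using (¬_; Dec; does; yes; no)
open import Relation.Nullary.Decidable using (⌊_⌋; _×-dec_; _⊎-dec_; ¬?)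
import Relation.Unary as U

open import Algebra.Properties.Semiring.Sum +-*-semiring
  using (sum-syntax; ∑-distrib-+; ∑-comm; sum-cong-≗; sum-replicate-zero; *-distribˡ-sum)

∑-zero : ∀ {n} {f : Fin n → ℕ} → (∀ i → f i ≡ 0) → ∑[ i < n ] f i ≡ 0
∑-zero {n} f≡0 = trans (sum-cong-≗ f≡0) (sum-replicate-zero n)

∑-const : ∀ n c → ∑[ i < n ] c ≡ n * c
∑-const zero    c = refl
∑-const (suc n) c = cong (c +_) (∑-const n c)

∑-mono-≤ : ∀ {n} {f g : Fin n → ℕ} → (∀ i → f i ≤ g i) → ∑[ i < n ] f i ≤ ∑[ i < n ] g i
∑-mono-≤ {zero}  f≤g = z≤n
∑-mono-≤ {suc n} f≤g = +-mono-≤ (f≤g zero) (∑-mono-≤ (f≤g ∘ suc))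

∑-mono-< : ∀ {n} {f g : Fin n → ℕ} → (∀ i → f i ≤ g i) → ∀ j → f j < g j → ∑[ i < n ] f i < ∑[ i < n ] g i
∑-mono-< f≤g zero    fj<gj = +-mono-<-≤ fj<gj (∑-mono-≤ (f≤g ∘ suc))
∑-mono-< f≤g (suc j) fj<gj = +-mono-≤-< (f≤g zero) (∑-mono-< (f≤g ∘ suc) j fj<gj)

term≤∑ : ∀ {n} (f : Fin n → ℕ) j → f j ≤ ∑[ i < n ] f i
term≤∑ f zero    = m≤m+n _ _
term≤∑ f (suc j) = ≤-trans (term≤∑ (f ∘ suc) j) (m≤n+m _ _)

∑-*ʳ : ∀ {n} (f : Fin n → ℕ) c → ∑[ i < n ] (f i * c) ≡ (∑[ i < n ] f i) * c
∑-*ʳ {zero}  f c = refl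
∑-*ʳ {suc n} f c = trans (cong (f zero * c +_) (∑-*ʳ (f ∘ suc) c)) (sym (*-distribʳ-+ c (f zero) _))

sum-allFin : ∀ n (f : Fin n → ℕ) → List.sum (map f (allFin n)) ≡ ∑[ i < n ] f i
sum-allFin n f = trans (cong List.sum (map-tabulate id f)) (sum-tabulate n f)
  where
  sum-tabulate : ∀ n (f : Fin n → ℕ) → List.sum (tabulate f) ≡ ∑[ i < n ] f i
  sum-tabulate zero    f = refl
  sum-tabulate (suc n) f = cong (f zero +_) (sum-tabulate n (f ∘ suc))

-- Through does rather than ⌊_⌋, so that 𝟙 (suc i ≟ suc j) reduces to 𝟙 (i ≟ j).
𝟙 : ∀ {a} {A : Set a} → Dec A → ℕ
𝟙 a? = ind (does a?)

𝟙-yes : ∀ {a} {A : Set a} (a? : Dec A) → A → 𝟙 a? ≡ 1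
𝟙-yes (yes _) a = refl
𝟙-yes (no ¬a) a = ⊥-elim (¬a a)

𝟙-no : ∀ {a} {A : Set a} (a? : Dec A) → ¬ A → 𝟙 a? ≡ 0
𝟙-no (yes a) ¬a = ⊥-elim (¬a a)
𝟙-no (no _)  ¬a = refl

∑-select : ∀ {n} (f : Fin n → ℕ) p → ∑[ x < n ] (𝟙 (p ≟ x) * f x) ≡ f p
∑-select {suc n} f zero    = trans (cong₂ _+_ (*-identityˡ (f zero)) (sum-replicate-zero n)) (+-identityʳ _)
∑-select {suc n} f (suc p) = ∑-select (f ∘ suc) p

∑-𝟙-injective≤1 : ∀ {a} {A : Set a} (_≟ᴬ_ : DecidableEquality A) {m} (h : Fin m → A) →
                Injective _≡_ _≡_ h → ∀ c → ∑[ i < m ] 𝟙 (h i ≟ᴬ c) ≤ 1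
∑-𝟙-injective≤1 _≟ᴬ_ {zero}  h inj c = z≤n
∑-𝟙-injective≤1 _≟ᴬ_ {suc m} h inj c with h zero ≟ᴬ c
... | no  _   = ∑-𝟙-injective≤1 _≟ᴬ_ (h ∘ suc) (suc-injective ∘ inj) c
... | yes h0≡c = s≤s (≤-reflexive (∑-zero λ i →
  𝟙-no (h (suc i) ≟ᴬ c) λ hi≡c → 0≢1+n (inj (trans h0≡c (sym hi≡c)))))

∑-∘-injective-≤ : ∀ {m n} (g : Fin m → Fin n) → Injective _≡_ _≡_ g → ∀ (f : Fin n → ℕ) →
                ∑[ i < m ] f (g i) ≤ ∑[ x < n ] f x
∑-∘-injective-≤ {m} {n} g inj f = begin
  ∑[ i < m ] f (g i)                          ≡⟨ sum-cong-≗ (λ i → sym (∑-select f (g i))) ⟩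
  ∑[ i < m ] ∑[ x < n ] (𝟙 (g i ≟ x) * f x)   ≡⟨ ∑-comm (λ i x → 𝟙 (g i ≟ x) * f x) ⟩
  ∑[ x < n ] ∑[ i < m ] (𝟙 (g i ≟ x) * f x)   ≡⟨ sum-cong-≗ (λ x → ∑-*ʳ (λ i → 𝟙 (g i ≟ x)) (f x)) ⟩
  ∑[ x < n ] (∑[ i < m ] 𝟙 (g i ≟ x) * f x)   ≤⟨ ∑-mono-≤ (λ x → *-monoˡ-≤ (f x) (∑-𝟙-injective≤1 _≟_ g inj x)) ⟩
  ∑[ x < n ] (1 * f x)                        ≡⟨ sum-cong-≗ (λ x → *-identityˡ (f x)) ⟩
  ∑[ x < n ] f x                              ∎
  where open ≤-Reasoning

∣a-b∣²+2ab≡a²+b²-ordered : ∀ {a b} → a ≤ b → ∣ a - b ∣ * ∣ a - b ∣ + 2 * (a * b) ≡ a * a + b * b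
∣a-b∣²+2ab≡a²+b²-ordered {a} a≤b with m≤n⇒∃[o]m+o≡n a≤b
... | t , refl rewrite ∣m-m+n∣≡n a t = expand a t
  where
  expand : ∀ a t → t * t + 2 * (a * (a + t)) ≡ a * a + (a + t) * (a + t)
  expand = solve-∀

∣a-b∣²+2ab≡a²+b² : ∀ a b → ∣ a - b ∣ * ∣ a - b ∣ + 2 * (a * b) ≡ a * a + b * b
∣a-b∣²+2ab≡a²+b² a b with ≤-total a b
... | inj₁ a≤b = ∣a-b∣²+2ab≡a²+b²-ordered a≤b
... | inj₂ b≤a = begin
  ∣ a - b ∣ * ∣ a - b ∣ + 2 * (a * b) ≡⟨ cong₂ (λ g p → g * g + 2 * p) (∣-∣-comm a b) (*-comm a b) ⟩
  ∣ b - a ∣ * ∣ b - a ∣ + 2 * (b * a) ≡⟨ ∣a-b∣²+2ab≡a²+b²-ordered b≤a ⟩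
  b * b + a * a                       ≡⟨ +-comm (b * b) (a * a) ⟩
  a * a + b * b                       ∎
  where open ≡-Reasoning

2ab≤a²+b² : ∀ a b → 2 * (a * b) ≤ a * a + b * b
2ab≤a²+b² a b = ≤-trans (m≤n+m _ (∣ a - b ∣ * ∣ a - b ∣)) (≤-reflexive (∣a-b∣²+2ab≡a²+b² a b))

2c∑b≤∑b²+mc² : ∀ {m} c (b : Fin m → ℕ) → 2 * (c * ∑[ i < m ] b i) ≤ ∑[ i < m ] (b i * b i) + m * (c * c)
2c∑b≤∑b²+mc² {m} c b = begin
  2 * (c * ∑[ i < m ] b i)                   ≡⟨ cong (2 *_) (*-distribˡ-sum c b) ⟩
  2 * ∑[ i < m ] (c * b i)                   ≡⟨ *-distribˡ-sum 2 (λ i → c * b i) ⟩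
  ∑[ i < m ] (2 * (c * b i))                 ≤⟨ ∑-mono-≤ (λ i → ≤-trans (2ab≤a²+b² c (b i)) (≤-reflexive (+-comm (c * c) _))) ⟩
  ∑[ i < m ] (b i * b i + c * c)             ≡⟨ ∑-distrib-+ (λ i → b i * b i) (λ _ → c * c) ⟩
  ∑[ i < m ] (b i * b i) + ∑[ i < m ] (c * c) ≡⟨ cong (∑[ i < m ] (b i * b i) +_) (∑-const m (c * c)) ⟩
  ∑[ i < m ] (b i * b i) + m * (c * c)       ∎
  where open ≤-Reasoning

cauchy-schwarz : ∀ {m} (a : Fin m → ℕ) → (∑[ i < m ] a i) * (∑[ i < m ] a i) ≤ m * ∑[ i < m ] (a i * a i)
cauchy-schwarz {zero}  a = z≤n
cauchy-schwarz {suc m} a = begin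
  (x + S) * (x + S)                 ≡⟨ square-+ x S ⟩
  x * x + 2 * (x * S) + S * S        ≤⟨ +-mono-≤ (+-monoʳ-≤ (x * x) (2c∑b≤∑b²+mc² x (a ∘ suc)))
                                                (cauchy-schwarz (a ∘ suc)) ⟩
  x * x + (Q + m * (x * x)) + m * Q  ≡⟨ regroup (x * x) Q m ⟩
  suc m * (x * x + Q)               ∎
  where
  open ≤-Reasoning
  x = a zero
  S = ∑[ i < m ] a (suc i)
  Q = ∑[ i < m ] (a (suc i) * a (suc i))
  square-+ : ∀ x s → (x + s) * (x + s) ≡ x * x + 2 * (x * s) + s * s
  square-+ = solve-∀
  regroup : ∀ p q m → p + (q + m * p) + m * q ≡ suc m * (p + q)
  regroup = solve-∀

m≤2^⌈log₂m⌉ : ∀ m → m ≤ 2 ^ ⌈log₂ m ⌉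
m≤2^⌈log₂m⌉ m = go m (<-wellFounded m)
  where
  go : ∀ m (rec : Acc _<_ m) → m ≤ 2 ^ ⌈log2⌉ m rec
  go zero                _        = z≤n
  go (suc zero)          _        = s≤s z≤n
  go (suc (suc k)) (acc rs) = ≤-trans 2+k≤2*[1+⌈k/2⌉] (*-monoʳ-≤ 2 (go (suc ⌈ k /2⌉) _))
    where
    2+k≤2*[1+⌈k/2⌉] : 2 + k ≤ 2 * suc ⌈ k /2⌉
    2+k≤2*[1+⌈k/2⌉] = begin
      2 + k                           ≡⟨ cong (2 +_) (sym (⌊n/2⌋+⌈n/2⌉≡n k)) ⟩
      2 + (⌊ k /2⌋ + ⌈ k /2⌉)        ≤⟨ +-monoʳ-≤ 2 (+-monoˡ-≤ ⌈ k /2⌉ (⌊n/2⌋≤⌈n/2⌉ k)) ⟩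
      2 + (⌈ k /2⌉ + ⌈ k /2⌉)        ≡⟨ double-suc ⌈ k /2⌉ ⟩
      2 * suc ⌈ k /2⌉                ∎
      where
      open ≤-Reasoning
      double-suc : ∀ c → 2 + (c + c) ≡ 2 * suc c
      double-suc = solve-∀

[m÷n]*n≤m : ∀ m n → (m ÷ n) * n ≤ m
[m÷n]*n≤m m zero    = z≤n
[m÷n]*n≤m m (suc n) = m/n*n≤m m (suc n)

m<[1+m÷n]*n : ∀ m n → 1 ≤ n → m < suc (m ÷ n) * n
m<[1+m÷n]*n m (suc n) _ = begin-strict
  m                               ≡⟨ m≡m%n+[m/n]*n m (suc n) ⟩
  m % suc n + (m / suc n) * suc n <⟨ +-monoˡ-< _ (m%n<n m (suc n)) ⟩
  suc n + (m / suc n) * suc n     ∎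
  where open ≤-Reasoning

m÷n≥1 : ∀ m n → 1 ≤ n → n ≤ m → 1 ≤ m ÷ n
m÷n≥1 m (suc n) _ n≤m = m≥n⇒m/n>0 n≤m

Minimum : (ℕ → Set) → Set
Minimum P = Σ ℕ λ m → P m × (∀ {j} → P j → m ≤ j)

minimum : ∀ {P : ℕ → Set} → U.Decidable P → ∀ {m} → P m → Minimum P
minimum {P} P? {m} = <-rec (λ m → P m → Minimum P) search m
  where
  search : ∀ m → (∀ {j} → j < m → P j → Minimum P) → P m → Minimum P
  search m smaller pm with anyUpTo? P? m
  ... | yes (j , j<m , pj) = smaller j<m pj
  ... | no  none           = m , pm , λ {j} pj → ≮⇒≥ (λ j<m → none (j , j<m , pj))

module Adjacency {n} (G : SimpleGraph n) where

  A : Fin n → Fin n → ℕ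
  A u w = ind (Adj G u w)

  A-sym : ∀ u w → A u w ≡ A w u
  A-sym u w = cong ind (SimpleGraph.sym G u w)

  A-irrefl : ∀ u → A u u ≡ 0
  A-irrefl u = cong ind (irrefl G u)

  ∑A≡deg : ∀ u → ∑[ w < n ] A u w ≡ deg G u
  ∑A≡deg u = sym (sum-allFin n (A u))

  adjSum : (Fin n → ℕ) → Fin n → ℕ
  adjSum y u = ∑[ w < n ] (A u w * y w)

  closedNbhd : Fin n → Fin n → ℕ
  closedNbhd p x = 𝟙 (p ≟ x) + A p x

  adjSum-mono : ∀ {y y′ : Fin n → ℕ} → (∀ x → y′ x ≤ y x) → ∀ u → adjSum y′ u ≤ adjSum y u
  adjSum-mono y′≤y u = ∑-mono-≤ (λ w → *-monoʳ-≤ (A u w) (y′≤y w))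

module Levels {n} (G : SimpleGraph n) (s : Fin n) (conn : Connected G) where
  open Adjacency G

  Edge : Fin n → Fin n → Set
  Edge u w = Adj G u w ≡ true

  Within : ℕ → Fin n → Set
  Within zero    u = u ≡ s
  Within (suc t) u = u ≡ s ⊎ ∃ λ w → Edge u w × Within t w

  within? : ∀ t u → Dec (Within t u)
  within? zero    u = u ≟ s
  within? (suc t) u = (u ≟ s) ⊎-dec any? (λ w → (Adj G u w ≟ᵇ true) ×-dec within? t w)

  walk⇒within : ∀ {u} → Star Edge u s → ∃ λ t → Within t u
  walk⇒within ε = 0 , refl
  walk⇒within (e ◅ walk) with walk⇒within walk
  ... | t , within = suc t , inj₂ (_ , e , within)

  level-minimum : ∀ u → Minimum (λ t → Within t u)
  level-minimum u = minimum (λ t → within? t u) (proj₂ (walk⇒within (conn u s)))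

  level : Fin n → ℕ
  level u = proj₁ (level-minimum u)

  within-level : ∀ u → Within (level u) u
  within-level u = proj₁ (proj₂ (level-minimum u))

  level-minimal : ∀ {u} t → Within t u → level u ≤ t
  level-minimal {u} t within = proj₂ (proj₂ (level-minimum u)) within

  level-sink : level s ≡ 0
  level-sink = n≤0⇒n≡0 (level-minimal 0 refl)

  level≡0⇒sink : ∀ {u} → level u ≡ 0 → u ≡ s
  level≡0⇒sink {u} eq = subst (λ t → Within t u) eq (within-level u)

  level-edge : ∀ {u w} → Edge u w → level u ≤ suc (level w)
  level-edge {u} {w} e = level-minimal (suc (level w)) (inj₂ (w , e , within-level w))

  downhill : ∀ u → u ≢ s → ∃ λ w → Edge u w × suc (level w) ≡ level u
  downhill u u≢s with level u in eq | within-level u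
  ... | zero  | u≡s                 = ⊥-elim (u≢s u≡s)
  ... | suc t | inj₁ u≡s            = ⊥-elim (u≢s u≡s)
  ... | suc t | inj₂ (w , e , within) =
    w , e , ≤-antisym (s≤s (level-minimal t within)) (subst (_≤ suc (level w)) eq (level-edge e))

  parent : Fin n → Fin n
  parent u with u ≟ s
  ... | yes _   = s
  ... | no  u≢s = proj₁ (downhill u u≢s)

  level-parent : ∀ u → level (parent u) ≡ level u ∸ 1
  level-parent u with u ≟ s
  ... | yes refl = trans level-sink (cong (_∸ 1) (sym level-sink))
  ... | no  u≢s  = cong (_∸ 1) (proj₂ (proj₂ (downhill u u≢s)))

  edge-parent : ∀ u → u ≢ s → Edge u (parent u)
  edge-parent u u≢s with u ≟ s
  ... | yes u≡s = ⊥-elim (u≢s u≡s)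
  ... | no  u≢s = proj₁ (proj₂ (downhill u u≢s))

  ancestor : ℕ → Fin n → Fin n
  ancestor zero    v = v
  ancestor (suc i) v = ancestor i (parent v)

  level-ancestor : ∀ i v → level (ancestor i v) ≡ level v ∸ i
  level-ancestor zero    v = refl
  level-ancestor (suc i) v = begin
    level (ancestor i (parent v)) ≡⟨ level-ancestor i (parent v) ⟩
    level (parent v) ∸ i          ≡⟨ cong (_∸ i) (level-parent v) ⟩
    level v ∸ 1 ∸ i               ≡⟨ ∸-+-assoc (level v) 1 i ⟩
    level v ∸ suc i               ∎
    where open ≡-Reasoning

  edge-ancestor : ∀ i v → i < level v → Edge (ancestor i v) (ancestor (suc i) v)
  edge-ancestor zero    v 0<l = edge-parent v λ v≡s → <⇒≢ 0<l (sym (trans (cong level v≡s) level-sink))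
  edge-ancestor (suc i) v i<l = edge-ancestor i (parent v) (subst (i <_) (sym (level-parent v)) (∸-monoˡ-< i<l (s≤s z≤n)))

  ancestor-level≡sink : ∀ v → ancestor (level v) v ≡ s
  ancestor-level≡sink v = level≡0⇒sink (trans (level-ancestor (level v) v) (n∸n≡0 (level v)))

  level-ancestor-injective : ∀ v → Injective _≡_ _≡_ (λ (i : Fin (level v)) → level (ancestor (toℕ i) v))
  level-ancestor-injective v {i} {j} eq = toℕ-injective (∸-cancelˡ-≡ (<⇒≤ (toℕ<n i)) (<⇒≤ (toℕ<n j))
    (trans (sym (level-ancestor (toℕ i) v)) (trans eq (level-ancestor (toℕ j) v))))

  closedNbhd≤level-indicators : ∀ p x → closedNbhd p x ≤
    𝟙 (level p ≟ℕ level x) + 𝟙 (level p ≟ℕ suc (level x)) + 𝟙 (suc (level p) ≟ℕ level x)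
  closedNbhd≤level-indicators p x with p ≟ x
  ... | yes refl rewrite A-irrefl p | 𝟙-yes (level p ≟ℕ level p) refl = s≤s z≤n
  ... | no  _ with Adj G p x in e
  ...   | false = z≤n
  ...   | true with <-cmp (level p) (level x)
  ...     | tri≈ _ lp≡lx _ rewrite 𝟙-yes (level p ≟ℕ level x) lp≡lx = s≤s z≤n
  ...     | tri> _ _ lp>lx
    rewrite 𝟙-yes (level p ≟ℕ suc (level x)) (≤-antisym (level-edge e) lp>lx) =
      ≤-trans (m≤n+m 1 (𝟙 (level p ≟ℕ level x))) (m≤m+n _ _)
  ...     | tri< lp<lx _ _
    rewrite 𝟙-yes (suc (level p) ≟ℕ level x)
                  (≤-antisym lp<lx (level-edge (trans (SimpleGraph.sym G x p) e))) = m≤n+m 1 _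

offSink : ∀ {n} → Fin n → Config n → Config n
offSink s σ v = if ⌊ v ≟ s ⌋ then 0 else σ v

offSink-≢ : ∀ {n} {s v : Fin n} (σ : Config n) → v ≢ s → offSink s σ v ≡ σ v
offSink-≢ {s = s} {v} σ v≢s with v ≟ s
... | yes v≡s = ⊥-elim (v≢s v≡s)
... | no  _   = refl

chipsOff≡∑offSink : ∀ {n} (s : Fin n) (σ : Config n) → chipsOff s σ ≡ ∑[ v < n ] offSink s σ v
chipsOff≡∑offSink {n} s σ = sum-allFin n (offSink s σ)

module Potentials {n} (G : SimpleGraph n) (s : Fin n) (d : ℕ) (reg : Regular G d) where
  open Adjacency G

  -- In terms of the Laplacian (Δy)_u = d·y_u − adjSum y u: Δy ≥ d off the sink,
  -- and Tight y says Δy ≤ 2d.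
  record Supersolution (y : Fin n → ℕ) : Set where
    field
      at-sink : y s ≡ 0
      drift   : ∀ u → u ≢ s → d + adjSum y u ≤ d * y u

  Tight : (Fin n → ℕ) → Set
  Tight y = ∀ u → d * y u ≤ d + d + adjSum y u

  ∑A≡d : ∀ u → ∑[ w < n ] A u w ≡ d
  ∑A≡d u = trans (∑A≡deg u) (reg u)

  adjSum-const : ∀ c u → adjSum (const c) u ≡ d * c
  adjSum-const c u = trans (∑-*ʳ (A u) c) (cong (_* c) (∑A≡d u))

  adjSum-+ : ∀ f g u → adjSum (λ x → f x + g x) u ≡ adjSum f u + adjSum g u
  adjSum-+ f g u = trans (sum-cong-≗ (λ w → *-distribˡ-+ (A u w) (f w) (g w)))
                         (∑-distrib-+ (λ w → A u w * f w) (λ w → A u w * g w))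

  ∑-adjSum : ∀ f → ∑[ u < n ] adjSum f u ≡ ∑[ w < n ] (d * f w)
  ∑-adjSum f = begin
    ∑[ u < n ] ∑[ w < n ] (A u w * f w) ≡⟨ ∑-comm (λ u w → A u w * f w) ⟩
    ∑[ w < n ] ∑[ u < n ] (A u w * f w) ≡⟨ sum-cong-≗ (λ w → sum-cong-≗ (λ u → cong (_* f w) (A-sym u w))) ⟩
    ∑[ w < n ] adjSum (const (f w)) w  ≡⟨ sum-cong-≗ (λ w → adjSum-const (f w) w) ⟩
    ∑[ w < n ] (d * f w)               ∎
    where open ≡-Reasoning

  module Existence (conn : Connected G) (d≥1 : 1 ≤ d) where
    open Levels G s conn

    -- The downhill neighbour w of u ≠ s has z_w = 2d·z_u, which pays for the drift;
    -- Δ kills the constant K^B, so y₀ = K^B − z is a supersolution.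
    K : ℕ
    K = d + d

    B : ℕ
    B = ∑[ u < n ] level u

    z : Fin n → ℕ
    z u = K ^ (B ∸ level u)

    y₀ : Fin n → ℕ
    y₀ u = K ^ B ∸ z u

    z≥1 : ∀ u → 1 ≤ z u
    z≥1 u = m^n>0 K {{>-nonZero (≤-trans d≥1 (m≤m+n d d))}} (B ∸ level u)

    y₀+z≡K^B : ∀ u → y₀ u + z u ≡ K ^ B
    y₀+z≡K^B u = m∸n+n≡m (^-monoʳ-≤ K {{>-nonZero (≤-trans d≥1 (m≤m+n d d))}} (m∸n≤m B (level u)))

    z-downhill : ∀ {u w} → suc (level w) ≡ level u → z w ≡ K * z u
    z-downhill {u} {w} eq = cong (K ^_) (begin
      B ∸ level w           ≡⟨ cong (suc B ∸_) eq ⟩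
      suc B ∸ level u       ≡⟨ +-∸-assoc 1 (term≤∑ level u) ⟩
      suc (B ∸ level u)     ∎)
      where open ≡-Reasoning

    d+d*z≤adjSum-z : ∀ u → u ≢ s → d + d * z u ≤ adjSum z u
    d+d*z≤adjSum-z u u≢s with downhill u u≢s
    ... | w , e , eq = begin
      d + d * z u         ≤⟨ +-monoˡ-≤ (d * z u) (m≤m*n d (z u) {{>-nonZero (z≥1 u)}}) ⟩
      d * z u + d * z u   ≡⟨ sym (*-distribʳ-+ (z u) d d) ⟩
      K * z u             ≡⟨ sym (z-downhill eq) ⟩
      z w                 ≡⟨ sym (*-identityˡ (z w)) ⟩
      1 * z w             ≡⟨ cong (λ b → ind b * z w) (sym e) ⟩
      A u w * z w         ≤⟨ term≤∑ (λ w → A u w * z w) w ⟩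
      adjSum z u          ∎
      where open ≤-Reasoning

    supersolution-y₀ : Supersolution y₀
    supersolution-y₀ = record { at-sink = y₀-sink ; drift = drift }
      where
      y₀-sink : y₀ s ≡ 0
      y₀-sink = trans (cong (λ l → K ^ B ∸ K ^ (B ∸ l)) level-sink) (n∸n≡0 (K ^ B))

      adjSum-y₀+z : ∀ u → adjSum y₀ u + adjSum z u ≡ d * y₀ u + d * z u
      adjSum-y₀+z u = begin
        adjSum y₀ u + adjSum z u          ≡⟨ sym (adjSum-+ y₀ z u) ⟩
        adjSum (λ x → y₀ x + z x) u       ≡⟨ sum-cong-≗ (λ w → cong (A u w *_) (y₀+z≡K^B w)) ⟩
        adjSum (const (K ^ B)) u          ≡⟨ adjSum-const (K ^ B) u ⟩
        d * K ^ B                         ≡⟨ cong (d *_) (sym (y₀+z≡K^B u)) ⟩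
        d * (y₀ u + z u)                  ≡⟨ *-distribˡ-+ d (y₀ u) (z u) ⟩
        d * y₀ u + d * z u                ∎
        where open ≡-Reasoning

      drift : ∀ u → u ≢ s → d + adjSum y₀ u ≤ d * y₀ u
      drift u u≢s = +-cancelʳ-≤ (d * z u) _ _ (begin
        d + adjSum y₀ u + d * z u       ≡⟨ shuffle d (adjSum y₀ u) (d * z u) ⟩
        adjSum y₀ u + (d + d * z u)     ≤⟨ +-monoʳ-≤ (adjSum y₀ u) (d+d*z≤adjSum-z u u≢s) ⟩
        adjSum y₀ u + adjSum z u        ≡⟨ adjSum-y₀+z u ⟩
        d * y₀ u + d * z u              ∎)
        where
        open ≤-Reasoning
        shuffle : ∀ a b c → a + b + c ≡ b + (a + c)
        shuffle = solve-∀

    lower : (Fin n → ℕ) → Fin n → Fin n → ℕ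
    lower y u = updateAt y u (_∸ 1)

    lower-≤ : ∀ y u x → lower y u x ≤ y x
    lower-≤ y u x with x ≟ u
    ... | yes refl = ≤-trans (≤-reflexive (updateAt-updates x y)) (m∸n≤m (y x) 1)
    ... | no  x≢u  = ≤-reflexive (updateAt-minimal x u y x≢u)

    Loose : (Fin n → ℕ) → Fin n → Set
    Loose y u = u ≢ s × d + d + adjSum y u ≤ d * y u

    lower-< : ∀ y u → Loose y u → lower y u u < y u
    lower-< y u (_ , loose) = subst (_< y u) (sym (updateAt-updates u y)) (pred< (y u) y≢0)
      where
      pred< : ∀ m → m ≢ 0 → m ∸ 1 < m
      pred< zero    m≢0 = ⊥-elim (m≢0 refl)
      pred< (suc m) _   = n<1+n m
      y≢0 : y u ≢ 0
      y≢0 yu≡0 = <⇒≱ (≤-trans d≥1 (≤-trans (m≤m+n d _) (≤-trans (m≤m+n (d + d) _) loose)))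
                     (≤-reflexive (trans (cong (d *_) yu≡0) (*-zeroʳ d)))

    -- Lowering y_u by one costs d of (Δy)_u and does not lower Δy elsewhere.
    lower-supersolution : ∀ {y} u → Supersolution y → Loose y u → Supersolution (lower y u)
    lower-supersolution {y} u sup (u≢s , loose) = record
      { at-sink = trans (updateAt-minimal s u y (λ s≡u → u≢s (sym s≡u))) at-sink
      ; drift   = drift′
      }
      where
      open Supersolution sup
      y′ = lower y u
      drift′ : ∀ x → x ≢ s → d + adjSum y′ x ≤ d * y′ x
      drift′ x x≢s with x ≟ u
      ... | no x≢u = begin
        d + adjSum y′ x  ≤⟨ +-monoʳ-≤ d (adjSum-mono (lower-≤ y u) x) ⟩
        d + adjSum y x   ≤⟨ drift x x≢s ⟩
        d * y x          ≡⟨ cong (d *_) (sym (updateAt-minimal x u y x≢u)) ⟩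
        d * y′ x         ∎
        where open ≤-Reasoning
      ... | yes refl = begin
        d + adjSum y′ x  ≤⟨ +-monoʳ-≤ d (adjSum-mono (lower-≤ y x) x) ⟩
        d + adjSum y x   ≤⟨ m+n≤o⇒m≤o∸n (d + adjSum y x) (≤-trans (≤-reflexive (shuffle d (adjSum y x))) loose) ⟩
        d * y x ∸ d      ≡⟨ sym (trans (*-distribˡ-∸ d (y x) 1) (cong (d * y x ∸_) (*-identityʳ d))) ⟩
        d * (y x ∸ 1)    ≡⟨ cong (d *_) (sym (updateAt-updates x y)) ⟩
        d * y′ x         ∎
        where
        open ≤-Reasoning
        shuffle : ∀ a b → a + b + a ≡ a + a + b
        shuffle = solve-∀

    tighten : ∀ fuel y → ∑[ x < n ] y x < fuel → Supersolution y → ∃ λ y → Supersolution y × Tight y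
    tighten (suc fuel) y ∑y<1+fuel sup
      with any? (λ u → ¬? (u ≟ s) ×-dec (d + d + adjSum y u ≤? d * y u))
    ... | yes (u , loose) = tighten fuel (lower y u)
            (<-≤-trans (∑-mono-< (lower-≤ y u) u (lower-< y u loose)) (≤-pred ∑y<1+fuel))
            (lower-supersolution u sup loose)
    ... | no  tight = y , sup , tight′
      where
      tight′ : Tight y
      tight′ u with u ≟ s
      ... | yes refl = ≤-trans (≤-reflexive (trans (cong (d *_) (Supersolution.at-sink sup)) (*-zeroʳ d))) z≤n
      ... | no  u≢s  = <⇒≤ (≰⇒> (λ loose → tight (u , u≢s , loose)))

    potential : ∃ λ y → Supersolution y × Tight y
    potential = tighten (suc (∑[ x < n ] y₀ x)) y₀ ≤-refl supersolution-y₀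

  ∑-closedNbhd : ∀ p → ∑[ x < n ] closedNbhd p x ≡ suc d
  ∑-closedNbhd p = begin
    ∑[ x < n ] (𝟙 (p ≟ x) + A p x)           ≡⟨ ∑-distrib-+ (λ x → 𝟙 (p ≟ x)) (A p) ⟩
    ∑[ x < n ] 𝟙 (p ≟ x) + ∑[ x < n ] A p x  ≡⟨ cong₂ _+_ ∑𝟙≡1 (∑A≡d p) ⟩
    suc d                                     ∎
    where
    open ≡-Reasoning
    ∑𝟙≡1 : ∑[ x < n ] 𝟙 (p ≟ x) ≡ 1
    ∑𝟙≡1 = trans (sum-cong-≗ (λ x → sym (*-identityʳ (𝟙 (p ≟ x))))) (∑-select (const 1) p)

  module Bound (conn : Connected G) {y : Fin n → ℕ} (sup : Supersolution y) (tight : Tight y) where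
    open Levels G s conn
    open Supersolution sup

    T : ℕ
    T = ∑[ x < n ] y x

    gap : Fin n → Fin n → ℕ
    gap u w = ∣ y u - y w ∣

    localEnergy : Fin n → ℕ
    localEnergy u = ∑[ w < n ] (A u w * (gap u w * gap u w))

    energy : ℕ
    energy = ∑[ u < n ] localEnergy u

    localEnergy-identity : ∀ u →
      localEnergy u + 2 * (y u * adjSum y u) ≡ d * (y u * y u) + adjSum (λ w → y w * y w) u
    localEnergy-identity u = begin
      localEnergy u + 2 * (y u * adjSum y u)
        ≡⟨ cong (localEnergy u +_) cross ⟩
      localEnergy u + ∑[ w < n ] (A u w * (2 * (y u * y w)))
        ≡⟨ sym (∑-distrib-+ (λ w → A u w * (gap u w * gap u w)) (λ w → A u w * (2 * (y u * y w)))) ⟩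
      ∑[ w < n ] (A u w * (gap u w * gap u w) + A u w * (2 * (y u * y w)))
        ≡⟨ sum-cong-≗ (λ w → trans (sym (*-distribˡ-+ (A u w) _ _))
             (trans (cong (A u w *_) (∣a-b∣²+2ab≡a²+b² (y u) (y w))) (*-distribˡ-+ (A u w) _ _))) ⟩
      ∑[ w < n ] (A u w * (y u * y u) + A u w * (y w * y w))
        ≡⟨ ∑-distrib-+ (λ w → A u w * (y u * y u)) (λ w → A u w * (y w * y w)) ⟩
      adjSum (const (y u * y u)) u + adjSum (λ w → y w * y w) u
        ≡⟨ cong (_+ adjSum (λ w → y w * y w) u) (adjSum-const (y u * y u) u) ⟩
      d * (y u * y u) + adjSum (λ w → y w * y w) u
        ∎
      where
      open ≡-Reasoning
      cross : 2 * (y u * adjSum y u) ≡ ∑[ w < n ] (A u w * (2 * (y u * y w)))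
      cross = trans (trans (sym (*-assoc 2 (y u) _)) (*-distribˡ-sum (2 * y u) (λ w → A u w * y w)))
                    (sum-cong-≗ (λ w → reorder (y u) (A u w) (y w)))
        where
        reorder : ∀ a b c → 2 * a * (b * c) ≡ b * (2 * (a * c))
        reorder = solve-∀

    -- energy = 2·Σ_u y_u·(Δy)_u, and Δy ≤ 2d.
    energy≤4dT : energy ≤ 4 * d * T
    energy≤4dT = +-cancelʳ-≤ (2 * X) energy (4 * d * T) (begin
      energy + 2 * X   ≡⟨ cong (energy +_) (*-distribˡ-sum 2 (λ u → y u * adjSum y u)) ⟩
      energy + ∑[ u < n ] (2 * (y u * adjSum y u))
                       ≡⟨ sym (∑-distrib-+ localEnergy (λ u → 2 * (y u * adjSum y u))) ⟩
      ∑[ u < n ] (localEnergy u + 2 * (y u * adjSum y u))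
                       ≡⟨ sum-cong-≗ localEnergy-identity ⟩
      ∑[ u < n ] (d * (y u * y u) + adjSum (λ w → y w * y w) u)
                       ≡⟨ ∑-distrib-+ (λ u → d * (y u * y u)) (adjSum (λ w → y w * y w)) ⟩
      Q + ∑[ u < n ] adjSum (λ w → y w * y w) u
                       ≡⟨ cong (Q +_) (∑-adjSum (λ w → y w * y w)) ⟩
      Q + Q            ≤⟨ +-mono-≤ Q≤ Q≤ ⟩
      (d + d) * T + X + ((d + d) * T + X)
                       ≡⟨ regroup d T X ⟩
      4 * d * T + 2 * X ∎)
      where
      open ≤-Reasoning
      X = ∑[ u < n ] (y u * adjSum y u)
      Q = ∑[ u < n ] (d * (y u * y u))
      regroup : ∀ d T X → (d + d) * T + X + ((d + d) * T + X) ≡ 4 * d * T + 2 * X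
      regroup = solve-∀
      Q≤ : Q ≤ (d + d) * T + X
      Q≤ = begin
        ∑[ u < n ] (d * (y u * y u))              ≡⟨ sum-cong-≗ (λ u → *-comm-middle d (y u)) ⟩
        ∑[ u < n ] (y u * (d * y u))              ≤⟨ ∑-mono-≤ (λ u → *-monoʳ-≤ (y u) (tight u)) ⟩
        ∑[ u < n ] (y u * (d + d + adjSum y u))   ≡⟨ sum-cong-≗ (λ u → *-distribˡ-+ (y u) (d + d) (adjSum y u)) ⟩
        ∑[ u < n ] (y u * (d + d) + y u * adjSum y u)
                                                  ≡⟨ ∑-distrib-+ (λ u → y u * (d + d)) (λ u → y u * adjSum y u) ⟩
        ∑[ u < n ] (y u * (d + d)) + X            ≡⟨ cong (_+ X) (trans (∑-*ʳ y (d + d)) (*-comm T (d + d))) ⟩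
        (d + d) * T + X                           ∎
        where
        *-comm-middle : ∀ d a → d * (a * a) ≡ a * (d * a)
        *-comm-middle = solve-∀

    stepGap : Fin n → ℕ → ℕ
    stepGap v i = gap (ancestor i v) (ancestor (suc i) v)

    y≤∑stepGap+y-ancestor : ∀ m v → y v ≤ ∑[ i < m ] stepGap v (toℕ i) + y (ancestor m v)
    y≤∑stepGap+y-ancestor zero    v = ≤-refl
    y≤∑stepGap+y-ancestor (suc m) v = begin
      y v                                                   ≤⟨ m≤∣m-n∣+n (y v) (y (parent v)) ⟩
      gap v (parent v) + y (parent v)                       ≤⟨ +-monoʳ-≤ (gap v (parent v)) (y≤∑stepGap+y-ancestor m (parent v)) ⟩
      gap v (parent v) + (∑[ i < m ] stepGap (parent v) (toℕ i) + y (ancestor m (parent v)))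
                                                            ≡⟨ sym (+-assoc (gap v (parent v)) _ _) ⟩
      ∑[ i < suc m ] stepGap v (toℕ i) + y (ancestor (suc m) v) ∎
      where open ≤-Reasoning

    y≤∑stepGap : ∀ v → y v ≤ ∑[ i < level v ] stepGap v (toℕ i)
    y≤∑stepGap v = ≤-trans (y≤∑stepGap+y-ancestor (level v) v) (≤-reflexive (begin
      S + y (ancestor (level v) v)   ≡⟨ cong (λ a → S + y a) (ancestor-level≡sink v) ⟩
      S + y s                        ≡⟨ cong (S +_) at-sink ⟩
      S + 0                          ≡⟨ +-identityʳ S ⟩
      S                              ∎))
      where
      open ≡-Reasoning
      S = ∑[ i < level v ] stepGap v (toℕ i)

    stepGap²≤localEnergy : ∀ v i → i < level v → stepGap v i * stepGap v i ≤ localEnergy (ancestor i v)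
    stepGap²≤localEnergy v i i<l = begin
      stepGap v i * stepGap v i       ≡⟨ sym (*-identityˡ _) ⟩
      1 * (stepGap v i * stepGap v i) ≡⟨ cong (λ b → ind b * (stepGap v i * stepGap v i)) (sym (edge-ancestor i v i<l)) ⟩
      A u w * (gap u w * gap u w)     ≤⟨ term≤∑ (λ w → A u w * (gap u w * gap u w)) w ⟩
      localEnergy u                   ∎
      where
      open ≤-Reasoning
      u = ancestor i v
      w = ancestor (suc i) v

    ∑-along-ancestors : ∀ v (f : Fin n → ℕ) → ∑[ i < level v ] f (ancestor (toℕ i) v) ≤ ∑[ x < n ] f x
    ∑-along-ancestors v = ∑-∘-injective-≤ (λ i → ancestor (toℕ i) v) (level-ancestor-injective v ∘ cong level)

    -- Levels along a shortest path are distinct and adjacent vertices have levels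
    -- differing by at most one, so each closed neighbourhood is met at most three times.
    level*[1+d]≤n*3 : ∀ v → level v * suc d ≤ n * 3
    level*[1+d]≤n*3 v = begin
      L * suc d                                    ≡⟨ sym (∑-const L (suc d)) ⟩
      ∑[ i < L ] suc d                             ≡⟨ sum-cong-≗ (λ i → sym (∑-closedNbhd (g i))) ⟩
      ∑[ i < L ] ∑[ x < n ] closedNbhd (g i) x     ≡⟨ ∑-comm (λ i x → closedNbhd (g i) x) ⟩
      ∑[ x < n ] ∑[ i < L ] closedNbhd (g i) x     ≤⟨ ∑-mono-≤ at-most-3 ⟩
      ∑[ x < n ] 3                                 ≡⟨ ∑-const n 3 ⟩
      n * 3                                        ∎
      where
      open ≤-Reasoning
      L = level v
      g : Fin L → Fin n
      g i = ancestor (toℕ i) v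
      h : Fin L → ℕ
      h i = level (g i)
      h-injective : Injective _≡_ _≡_ h
      h-injective = level-ancestor-injective v
      at-most-3 : ∀ x → ∑[ i < L ] closedNbhd (g i) x ≤ 3
      at-most-3 x = begin
        ∑[ i < L ] closedNbhd (g i) x                    ≤⟨ ∑-mono-≤ (λ i → closedNbhd≤level-indicators (g i) x) ⟩
        ∑[ i < L ] (same i + below i + above i)          ≡⟨ ∑-distrib-+ (λ i → same i + below i) above ⟩
        ∑[ i < L ] (same i + below i) + ∑[ i < L ] above i
                                                         ≡⟨ cong (_+ ∑[ i < L ] above i) (∑-distrib-+ same below) ⟩
        ∑[ i < L ] same i + ∑[ i < L ] below i + ∑[ i < L ] above i
                                                         ≤⟨ +-mono-≤ (+-mono-≤ at-most-1 at-most-1) at-most-1′ ⟩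
        3                                                ∎
        where
        same below above : Fin L → ℕ
        same  i = 𝟙 (h i ≟ℕ level x)
        below i = 𝟙 (h i ≟ℕ suc (level x))
        above i = 𝟙 (suc (h i) ≟ℕ level x)
        at-most-1 : ∀ {c} → ∑[ i < L ] 𝟙 (h i ≟ℕ c) ≤ 1
        at-most-1 = ∑-𝟙-injective≤1 _≟ℕ_ h h-injective _
        at-most-1′ : ∑[ i < L ] above i ≤ 1
        at-most-1′ = ∑-𝟙-injective≤1 _≟ℕ_ (suc ∘ h) (h-injective ∘ Data.Nat.Properties.suc-injective) (level x)

    y²≤12nT : ∀ v → y v * y v ≤ 12 * n * T
    y²≤12nT v = begin
      y v * y v                           ≤⟨ *-mono-≤ (y≤∑stepGap v) (y≤∑stepGap v) ⟩
      ∑[ i < L ] a i * ∑[ i < L ] a i     ≤⟨ cauchy-schwarz a ⟩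
      L * ∑[ i < L ] (a i * a i)          ≤⟨ *-monoʳ-≤ L (∑-mono-≤ (λ i → stepGap²≤localEnergy v (toℕ i) (toℕ<n i))) ⟩
      L * ∑[ i < L ] localEnergy (ancestor (toℕ i) v)
                                          ≤⟨ *-monoʳ-≤ L (∑-along-ancestors v localEnergy) ⟩
      L * energy                          ≤⟨ *-monoʳ-≤ L energy≤4dT ⟩
      L * (4 * d * T)                     ≡⟨ reassoc L d T ⟩
      4 * (L * d) * T                     ≤⟨ *-monoˡ-≤ T (*-monoʳ-≤ 4 (≤-trans (*-monoʳ-≤ L (n≤1+n d)) (level*[1+d]≤n*3 v))) ⟩
      4 * (n * 3) * T                     ≡⟨ cong (_* T) (reassoc′ n) ⟩
      12 * n * T                          ∎
      where
      open ≤-Reasoning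
      L = level v
      a : Fin L → ℕ
      a i = stepGap v (toℕ i)
      reassoc : ∀ L d T → L * (4 * d * T) ≡ 4 * (L * d) * T
      reassoc = solve-∀
      reassoc′ : ∀ n → 4 * (n * 3) ≡ 12 * n
      reassoc′ = solve-∀

    T≤12n³ : T ≤ 12 * n * n * n
    T≤12n³ with T in eq
    ... | zero  = z≤n
    ... | suc t = *-cancelʳ-≤ (suc t) (12 * n * n * n) (suc t) (begin
      suc t * suc t                         ≡⟨ cong (λ x → x * x) (sym eq) ⟩
      T * T                                 ≤⟨ cauchy-schwarz y ⟩
      n * ∑[ v < n ] (y v * y v)            ≤⟨ *-monoʳ-≤ n (∑-mono-≤ y²≤12nT) ⟩
      n * ∑[ v < n ] (12 * n * T)           ≡⟨ cong (n *_) (∑-const n (12 * n * T)) ⟩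
      n * (n * (12 * n * T))                ≡⟨ reassoc n T ⟩
      12 * n * n * n * T                    ≡⟨ cong (12 * n * n * n *_) eq ⟩
      12 * n * n * n * suc t                ∎)
      where
      open ≤-Reasoning
      reassoc : ∀ n T → n * (n * (12 * n * T)) ≡ 12 * n * n * n * T
      reassoc = solve-∀

  module Greedy (d≥1 : 1 ≤ d) {y : Fin n → ℕ} (sup : Supersolution y) where
    open Supersolution sup

    Φ : Config n → ℕ
    Φ σ = ∑[ x < n ] (y x * σ x)

    M : ℕ
    M = suc (2 * ∑[ x < n ] y x)

    fire-at : ∀ σ u x → let k = σ u ÷ deg G u in
      y x * greedyFire G s σ u x + 𝟙 (u ≟ x) * (k * deg G u * y u) ≡ y x * σ x + k * (A u x * y x)
    fire-at σ u x with x ≟ u | x ≟ s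
    ... | yes refl | _ rewrite 𝟙-yes (x ≟ x) refl | A-irrefl x = begin
      y x * (σ x ∸ kd) + 1 * (kd * y x) ≡⟨ collect (y x) (σ x ∸ kd) kd ⟩
      y x * (σ x ∸ kd + kd)             ≡⟨ cong (y x *_) (m∸n+n≡m ([m÷n]*n≤m (σ x) (deg G x))) ⟩
      y x * σ x                         ≡⟨ sym (+-identityʳ _) ⟩
      y x * σ x + 0                     ≡⟨ cong (y x * σ x +_) (sym (*-zeroʳ k)) ⟩
      y x * σ x + k * 0                 ∎
      where
      open ≡-Reasoning
      k = σ x ÷ deg G x
      kd = k * deg G x
      collect : ∀ a b c → a * b + 1 * (c * a) ≡ a * (b + c)
      collect = solve-∀
    ... | no x≢u | yes refl rewrite 𝟙-no (u ≟ x) (x≢u ∘ sym) | at-sink =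
      sym (trans (cong ((σ u ÷ deg G u) *_) (*-zeroʳ (A u x))) (*-zeroʳ (σ u ÷ deg G u)))
    ... | no x≢u | no _ rewrite 𝟙-no (u ≟ x) (x≢u ∘ sym) with Adj G u x
    ...   | true  = spread (y x) (σ x) (σ u ÷ deg G u)
      where
      spread : ∀ a b k → a * (b + k) + 0 ≡ a * b + k * (1 * a)
      spread = solve-∀
    ...   | false = unchanged (y x) (σ x) (σ u ÷ deg G u)
      where
      unchanged : ∀ a b k → a * b + 0 ≡ a * b + k * (0 * a)
      unchanged = solve-∀

    Φ-fire : ∀ σ u → let k = σ u ÷ deg G u in
      Φ (greedyFire G s σ u) + k * deg G u * y u ≡ Φ σ + k * adjSum y u
    Φ-fire σ u = begin
      Φ σ′ + c                                               ≡⟨ cong (Φ σ′ +_) (sym (∑-select (const c) u)) ⟩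
      Φ σ′ + ∑[ x < n ] (𝟙 (u ≟ x) * c)                      ≡⟨ sym (∑-distrib-+ (λ x → y x * σ′ x) (λ x → 𝟙 (u ≟ x) * c)) ⟩
      ∑[ x < n ] (y x * σ′ x + 𝟙 (u ≟ x) * c)                ≡⟨ sum-cong-≗ (fire-at σ u) ⟩
      ∑[ x < n ] (y x * σ x + k * (A u x * y x))             ≡⟨ ∑-distrib-+ (λ x → y x * σ x) (λ x → k * (A u x * y x)) ⟩
      Φ σ + ∑[ x < n ] (k * (A u x * y x))                   ≡⟨ cong (Φ σ +_) (sym (*-distribˡ-sum k (λ x → A u x * y x))) ⟩
      Φ σ + k * adjSum y u                                   ∎
      where
      open ≡-Reasoning
      σ′ = greedyFire G s σ u
      k = σ u ÷ deg G u
      c = k * deg G u * y u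

    module Step {σ σ′} (step : GreedyStep G s σ σ′) where
      w : Fin n
      w = proj₁ (proj₁ step)

      u : Fin n
      u = proj₁ (proj₂ step)

      u≢s : u ≢ s
      u≢s = proj₁ (proj₂ (proj₂ step))

      maximal : ∀ v → v ≢ s → σ v ÷ deg G v ≤ σ u ÷ deg G u
      maximal = proj₁ (proj₂ (proj₂ (proj₂ step)))

      σ′≡ : ∀ v → σ′ v ≡ greedyFire G s σ u v
      σ′≡ = proj₂ (proj₂ (proj₂ (proj₂ step)))

      k : ℕ
      k = σ u ÷ deg G u

      k≥1 : 1 ≤ k
      k≥1 with proj₂ (proj₁ step)
      ... | w≢s , full =
        ≤-trans (m÷n≥1 (σ w) (deg G w) (≤-trans d≥1 (≤-reflexive (sym (reg w)))) full) (maximal w w≢s)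

      Φ-drop : Φ σ′ + k * d ≤ Φ σ
      Φ-drop = +-cancelʳ-≤ (k * adjSum y u) _ _ (begin
        Φ σ′ + k * d + k * adjSum y u            ≡⟨ trans (+-assoc (Φ σ′) _ _) (cong (Φ σ′ +_) (sym (*-distribˡ-+ k d _))) ⟩
        Φ σ′ + k * (d + adjSum y u)              ≤⟨ +-monoʳ-≤ (Φ σ′) (*-monoʳ-≤ k (drift u u≢s)) ⟩
        Φ σ′ + k * (d * y u)                     ≡⟨ cong₂ _+_ (sum-cong-≗ (λ x → cong (y x *_) (σ′≡ x)))
                                                        (trans (sym (*-assoc k d (y u))) (cong (λ e → k * e * y u) (sym (reg u)))) ⟩
        Φ (greedyFire G s σ u) + k * deg G u * y u ≡⟨ Φ-fire σ u ⟩
        Φ σ + k * adjSum y u                     ∎)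
        where open ≤-Reasoning

      Φ≤ : Φ σ ≤ suc k * d * ∑[ x < n ] y x
      Φ≤ = ≤-trans (∑-mono-≤ term≤)
             (≤-reflexive (trans (sum-cong-≗ (λ x → *-comm (y x) (suc k * d))) (sym (*-distribˡ-sum (suc k * d) y))))
        where
        term≤ : ∀ x → y x * σ x ≤ y x * (suc k * d)
        term≤ x with x ≟ s
        ... | yes refl rewrite at-sink = z≤n
        ... | no  x≢s  = *-monoʳ-≤ (y x) (begin
          σ x                         ≤⟨ <⇒≤ (m<[1+m÷n]*n (σ x) (deg G x) (≤-trans d≥1 (≤-reflexive (sym (reg x))))) ⟩
          suc (σ x ÷ deg G x) * deg G x ≡⟨ cong (λ e → suc (σ x ÷ e) * e) (reg x) ⟩
          suc (σ x ÷ d) * d           ≤⟨ *-monoˡ-≤ d (s≤s (subst (λ e → σ x ÷ e ≤ k) (reg x) (maximal x x≢s))) ⟩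
          suc k * d                   ∎)
          where open ≤-Reasoning

      decreases : Φ σ′ < Φ σ
      decreases = <-≤-trans (m<m+n (Φ σ′) (*-mono-≤ k≥1 d≥1)) Φ-drop

      contracts : suc M * Φ σ′ ≤ M * Φ σ
      contracts = begin
        suc M * Φ σ′           ≡⟨⟩
        Φ σ′ + M * Φ σ′        ≤⟨ +-monoˡ-≤ (M * Φ σ′) Φ′≤M*kd ⟩
        M * (k * d) + M * Φ σ′ ≡⟨ trans (sym (*-distribˡ-+ M (k * d) (Φ σ′))) (cong (M *_) (+-comm (k * d) (Φ σ′))) ⟩
        M * (Φ σ′ + k * d)     ≤⟨ *-monoʳ-≤ M Φ-drop ⟩
        M * Φ σ                ∎
        where
        open ≤-Reasoning
        T = ∑[ x < n ] y x
        Φ′≤M*kd : Φ σ′ ≤ M * (k * d)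
        Φ′≤M*kd = begin
          Φ σ′                  ≤⟨ <⇒≤ decreases ⟩
          Φ σ                   ≤⟨ Φ≤ ⟩
          suc k * d * T         ≤⟨ *-monoˡ-≤ T (*-monoˡ-≤ d (+-monoˡ-≤ k k≥1)) ⟩
          (k + k) * d * T       ≤⟨ m≤m+n _ (k * d) ⟩
          (k + k) * d * T + k * d ≡⟨ regroup k d T ⟩
          M * (k * d)           ∎
          where
          regroup : ∀ k d T → (k + k) * d * T + k * d ≡ suc (2 * T) * (k * d)
          regroup = solve-∀

    Φ≤∑y*chipsOff : ∀ σ → Φ σ ≤ (∑[ x < n ] y x) * chipsOff s σ
    Φ≤∑y*chipsOff σ = begin
      ∑[ x < n ] (y x * σ x)              ≤⟨ ∑-mono-≤ term≤ ⟩
      ∑[ x < n ] (T * offSink s σ x)      ≡⟨ sym (*-distribˡ-sum T (offSink s σ)) ⟩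
      T * ∑[ x < n ] offSink s σ x        ≡⟨ cong (T *_) (sym (chipsOff≡∑offSink s σ)) ⟩
      T * chipsOff s σ                    ∎
      where
      open ≤-Reasoning
      T = ∑[ x < n ] y x
      term≤ : ∀ x → y x * σ x ≤ T * offSink s σ x
      term≤ x with x ≟ s
      ... | yes refl rewrite at-sink = z≤n
      ... | no  _    = *-monoˡ-≤ (σ x) (term≤∑ y x)

module RunLength {n} (G : SimpleGraph n) (s : Fin n) (Φ : Config n → ℕ) (M : ℕ) .{{_ : NonZero M}}
  (decreases : ∀ {σ σ′} → GreedyStep G s σ σ′ → Φ σ′ < Φ σ)
  (contracts : ∀ {σ σ′} → GreedyStep G s σ σ′ → suc M * Φ σ′ ≤ M * Φ σ) where

  run-monotone : ∀ {k σ σ′} → GreedyRun G s k σ σ′ → Φ σ′ ≤ Φ σ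
  run-monotone done            = ≤-refl
  run-monotone (step st rest) = ≤-trans (run-monotone rest) (<⇒≤ (decreases st))

  run-contracts : ∀ {k σ σ′} → GreedyRun G s k σ σ′ → (M + k) * Φ σ′ ≤ M * Φ σ
  run-contracts {σ = σ} done = ≤-reflexive (cong (_* Φ σ) (+-identityʳ M))
  run-contracts {suc k} {σ} {σ″} (step {σ' = σ′} st rest) = begin
    (M + suc k) * Φ σ″      ≡⟨ cong (_* Φ σ″) (+-suc M k) ⟩
    Φ σ″ + (M + k) * Φ σ″   ≤⟨ +-mono-≤ (run-monotone rest) (run-contracts rest) ⟩
    Φ σ′ + M * Φ σ′         ≤⟨ contracts st ⟩
    M * Φ σ                 ∎
    where open ≤-Reasoning

  run-split : ∀ m {k σ σ″} → GreedyRun G s (m + k) σ σ″ → ∃ λ σ′ → GreedyRun G s m σ σ′ × GreedyRun G s k σ′ σ″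
  run-split zero    run            = _ , done , run
  run-split (suc m) (step st rest) with run-split m rest
  ... | σ′ , first , second = σ′ , step st first , second

  run-halves : ∀ {σ σ′} → GreedyRun G s M σ σ′ → 2 * Φ σ′ ≤ Φ σ
  run-halves {σ} {σ′} run = *-cancelˡ-≤ M (begin
    M * (2 * Φ σ′)   ≡⟨ double M (Φ σ′) ⟩
    (M + M) * Φ σ′   ≤⟨ run-contracts run ⟩
    M * Φ σ          ∎)
    where
    open ≤-Reasoning
    double : ∀ M x → M * (2 * x) ≡ (M + M) * x
    double = solve-∀

  run-length : ∀ j {k σ σ′} → GreedyRun G s k σ σ′ → Φ σ < 2 ^ j → k ≤ M * j
  run-length zero    done           _   = z≤n
  run-length zero    (step st _)    Φ<1 = ⊥-elim (n≮0 (<-≤-trans (decreases st) (≤-pred Φ<1)))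
  run-length (suc j) {k} {σ} {σ″} run Φ< with k ≤? M
  ... | yes k≤M = ≤-trans k≤M (m≤m*n M (suc j))
  ... | no  k≰M with run-split M (subst (λ k → GreedyRun G s k σ σ″) (sym (m+[n∸m]≡n M≤k)) run)
    where M≤k = ≤-trans (n≤1+n M) (≰⇒> k≰M)
  ...   | σ′ , first , rest = begin
    k                  ≡⟨ sym (m+[n∸m]≡n M≤k) ⟩
    M + (k ∸ M)        ≤⟨ +-monoʳ-≤ M (run-length j rest Φ′<) ⟩
    M + M * j          ≡⟨ sym (*-suc M j) ⟩
    M * suc j          ∎
    where
    open ≤-Reasoning
    M≤k = ≤-trans (n≤1+n M) (≰⇒> k≰M)
    Φ′< : Φ σ′ < 2 ^ j
    Φ′< = *-cancelˡ-< 2 (Φ σ′) (2 ^ j) (<-≤-trans (s≤s (run-halves first)) Φ<)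

deg≥1 : ∀ {n} (G : SimpleGraph n) {s w : Fin n} → Connected G → w ≢ s → 1 ≤ deg G w
deg≥1 G {s} {w} conn w≢s with conn w s
... | ε                 = ⊥-elim (w≢s refl)
... | _◅_ {j = x} e _ = begin
  1                    ≡⟨ cong ind (sym e) ⟩
  A w x                ≤⟨ term≤∑ (A w) x ⟩
  ∑[ v < _ ] A w v     ≡⟨ ∑A≡deg w ⟩
  deg G w              ∎
  where
  open ≤-Reasoning
  open Adjacency G

≢⇒2≤n : ∀ {n} {a b : Fin n} → a ≢ b → 2 ≤ n
≢⇒2≤n {suc zero}    {zero} {zero} a≢b = ⊥-elim (a≢b refl)
≢⇒2≤n {suc (suc n)} _                = s≤s (s≤s z≤n)

≤chipsOff : ∀ {n} {s w : Fin n} (σ : Config n) → w ≢ s → σ w ≤ chipsOff s σ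
≤chipsOff {n} {s} {w} σ w≢s = begin
  σ w                          ≡⟨ sym (offSink-≢ σ w≢s) ⟩
  offSink s σ w                ≤⟨ term≤∑ (offSink s σ) w ⟩
  ∑[ v < n ] offSink s σ v     ≡⟨ sym (chipsOff≡∑offSink s σ) ⟩
  chipsOff s σ                 ∎
  where open ≤-Reasoning

12n³N<2^[5+3⌈log₂nN⌉] : ∀ n N → 1 ≤ N → 12 * n * n * n * N < 2 ^ (5 + ⌈log₂ (n * N)⌉ * 3)
12n³N<2^[5+3⌈log₂nN⌉] n N N≥1 = begin-strict
  12 * n * n * n * N                 ≤⟨ *-monoˡ-≤ N (*-monoˡ-≤ n (*-monoˡ-≤ n (*-monoˡ-≤ n (m≤m+n 12 4)))) ⟩
  16 * n * n * n * N                 ≤⟨ *-monoʳ-≤ (16 * n * n * n) N≤N³ ⟩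
  16 * n * n * n * (N * (N * N))     ≡⟨ cube n N ⟩
  16 * (n * N) ^ 3                   ≤⟨ *-monoʳ-≤ 16 (^-monoˡ-≤ 3 (m≤2^⌈log₂m⌉ (n * N))) ⟩
  16 * (2 ^ ℓ) ^ 3                   ≡⟨ cong (16 *_) (^-*-assoc 2 ℓ 3) ⟩
  16 * 2 ^ (ℓ * 3)                   <⟨ *-monoˡ-< (2 ^ (ℓ * 3)) {{m^n≢0 2 (ℓ * 3)}} (m≤m+n 17 15) ⟩
  32 * 2 ^ (ℓ * 3)                   ≡⟨ times32 (2 ^ (ℓ * 3)) ⟩
  2 ^ (5 + ℓ * 3)                    ∎
  where
  open ≤-Reasoning
  ℓ = ⌈log₂ (n * N)⌉
  N≤N³ : N ≤ N * (N * N)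
  N≤N³ = m≤m*n N (N * N) {{>-nonZero (*-mono-≤ N≥1 N≥1)}}
  cube : ∀ n N → 16 * n * n * n * (N * (N * N)) ≡ 16 * (n * N * (n * N * (n * N * 1)))
  cube = solve-∀
  times32 : ∀ x → 32 * x ≡ 2 * (2 * (2 * (2 * (2 * x))))
  times32 = solve-∀

[1+2T]*[5+3l]≤200n³l : ∀ n T l → 1 ≤ n → 1 ≤ l → T ≤ 12 * n * n * n → suc (2 * T) * (5 + l * 3) ≤ 200 * (n ^ 3 * l)
[1+2T]*[5+3l]≤200n³l n T l n≥1 l≥1 T≤ = begin
  suc (2 * T) * (5 + l * 3)                    ≤⟨ *-mono-≤ (s≤s (*-monoʳ-≤ 2 T≤)) (+-monoˡ-≤ (l * 3) (*-monoʳ-≤ 5 l≥1)) ⟩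
  suc (2 * (12 * n * n * n)) * (5 * l + l * 3) ≤⟨ *-monoˡ-≤ (5 * l + l * 3) (+-monoˡ-≤ (2 * (12 * n * n * n)) n³≥1) ⟩
  (n * n * n + 2 * (12 * n * n * n)) * (5 * l + l * 3) ≡⟨ collect n l ⟩
  200 * (n ^ 3 * l)                            ∎
  where
  open ≤-Reasoning
  n³≥1 : 1 ≤ n * n * n
  n³≥1 = *-mono-≤ (*-mono-≤ n≥1 n≥1) n≥1
  collect : ∀ n l → (n * n * n + 2 * (12 * n * n * n)) * (5 * l + l * 3) ≡ 200 * (n * (n * (n * 1)) * l)
  collect = solve-∀

theorem4p5 : ∃ λ (C : ℕ) →
    ∀ (n d : ℕ) (G : SimpleGraph n) (s : Fin n) →
      Connected G → Regular G d →
      ∀ (σ : Config n) (k : ℕ) (σ' : Config n) →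
        GreedyRun G s k σ σ' →
        k ≤ C * (n ^ 3 * ⌈log₂ (n * chipsOff s σ) ⌉)
theorem4p5 = 200 , bound
  where
  bound : ∀ (n d : ℕ) (G : SimpleGraph n) (s : Fin n) → Connected G → Regular G d →
          ∀ (σ : Config n) (k : ℕ) (σ′ : Config n) → GreedyRun G s k σ σ′ →
          k ≤ 200 * (n ^ 3 * ⌈log₂ (n * chipsOff s σ) ⌉)
  bound n d G s conn reg σ zero    σ′ done = z≤n
  bound n d G s conn reg σ (suc k) σ′ run@(step ((w , w≢s , full) , _) _) =
    ≤-trans (run-length j run Φσ<2^j) ([1+2T]*[5+3l]≤200n³l n T ℓ n≥1 ℓ≥1 T≤12n³)
    where
    open Potentials G s d reg
    N ℓ j : ℕ
    N = chipsOff s σ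
    ℓ = ⌈log₂ (n * N)⌉
    j = 5 + ℓ * 3
    n≥1 : 1 ≤ n
    n≥1 = ≤-trans (s≤s z≤n) (≢⇒2≤n w≢s)
    d≥1 : 1 ≤ d
    d≥1 = subst (1 ≤_) (reg w) (deg≥1 G conn w≢s)
    N≥1 : 1 ≤ N
    N≥1 = ≤-trans (deg≥1 G conn w≢s) (≤-trans full (≤chipsOff σ w≢s))
    ℓ≥1 : 1 ≤ ℓ
    ℓ≥1 = subst (_≤ ℓ) (⌈log₂2^n⌉≡n 1) (⌈log₂⌉-mono-≤ (*-mono-≤ (≢⇒2≤n w≢s) N≥1))
    potential : ∃ λ y → Supersolution y × Tight y
    potential = Existence.potential conn d≥1
    open Greedy d≥1 (proj₁ (proj₂ potential))
    open Bound conn (proj₁ (proj₂ potential)) (proj₂ (proj₂ potential)) using (T; T≤12n³)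
    open RunLength G s Φ M (λ st → Step.decreases st) (λ st → Step.contracts st)
    Φσ<2^j : Φ σ < 2 ^ j
    Φσ<2^j = ≤-<-trans (≤-trans (Φ≤∑y*chipsOff σ) (*-monoˡ-≤ N T≤12n³)) (12n³N<2^[5+3⌈log₂nN⌉] n N N≥1)
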